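{- Let $N = q^k n^2$ be an odd perfect number given in Eulerian form. Set $E = n$, $F = \sigma(q^k)/2$, $G = \gcd(\sigma(q^k),\sigma(n^2))$, $H = \gcd(n^2,\sigma(n^2))$, $I = \gcd(n,\sigma(n^2))$ and $J = H/I$. Then (1) $\frac{9}{F} \le G \le F$; (2) $\frac{3E}{F} \le I \le E$; (3) $\frac{E}{F} \le J \le \frac{E}{3}$.
   Context: $\sigma(x)$ denotes the sum of the positive divisors of $x$. A positive integer $N$ is perfect if $\sigma(N)=2N$. An odd perfect number $N$ is said to be given in Eulerian form $N = q^k n^2$ if $q$ is a prime (the special prime), $k$ and $n$ are positive integers, $q \equiv k \equiv 1 \pmod 4$, and $\gcd(q,n)=1$. -}

module Defs where

open import Data.Nat using (ℕ; suc; _+_; _*_; _^_; _≡ᵇ_)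
open import Data.Nat.Divisibility using (_∣_; _∣?_)
open import Data.Nat.Primality using (Prime)
open import Data.Nat.GCD using (gcd)
open import Data.List using (List; filter; upTo; map)
open import Data.Nat.ListAction using (sum)
open import Data.Product using (_×_; ∃)
open import Relation.Binary.PropositionalEquality using (_≡_)

-- sum of the positive divisors of x (σ 0 = 0, irrelevant here)
σ : ℕ → ℕ
σ x = sum (filter (λ d → d ∣? x) (map suc (upTo x)))

Perfect : ℕ → Set
Perfect N = σ N ≡ 2 * N

Odd : ℕ → Set
Odd N = ∃ λ m → N ≡ 2 * m + 1

EulerianOPN : ℕ → ℕ → ℕ → ℕ → Set
EulerianOPN N q k n =
  Odd N × Perfect N × N ≡ q ^ k * (n * n) × Prime q ×
  (∃ λ a → q ≡ 4 * a + 1) × (∃ λ b → k ≡ 4 * b + 1) × gcd q n ≡ 1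

-- Since q ≡ k ≡ 1 (mod 4), σ(q^k) = 1 + q + ⋯ + q^k is a sum of an even number of odd
-- terms, so σ(q^k) = 2F, and F is prime to q because σ(q^k) ≡ 1 (mod q). By multiplicativity
-- of σ, perfection reads F·σ(n²) = q^k·n², whence n² = mF and σ(n²) = q^k·m. Then
-- G = gcd(2F, q^k m) divides F (q^k m is odd), and H = m·gcd(F, q^k) = m = J·I.
-- If F < 9 then F is an odd prime dividing n², so F ∣ m and F ∣ G, giving GF ≥ F² ≥ 9.
-- For g = gcd(n, m) ∣ I the cofactors n/g and m/g are coprime, so n/g ∣ F and gF = tn;
-- t = 1 would force F = 1 and t = 2 an even F, so t ≥ 3. The bounds on J follow from JI = m = n²/F.
module Submission where

open import Data.Empty using (⊥-elim)
open import Data.List using ([]; _∷_; filter; map; upTo; applyUpTo)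
open import Data.List.Properties using (map-upTo; map-applyUpTo)
open import Data.Nat
open import Data.Nat.Properties
open import Data.Nat.Divisibility
open import Data.Nat.DivMod using (m*[n/m]≡n; m*n/n≡m)
open import Data.Nat.GCD
open import Data.Nat.Coprimality using (Coprime; coprime-divisor; coprime-/gcd; coprime⇒gcd≡1)
open import Data.Nat.ListAction using (sum)
open import Data.Nat.Primality using (Prime; prime?; prime[2]; prime⇒irreducible; prime⇒nonZero; euclidsLemma; ¬prime[1])
open import Data.Nat.Solver using (module +-*-Solver)
open import Data.Product using (_×_; _,_; ∃; proj₁; proj₂)
open import Data.Sum using (inj₁; inj₂)
open import Function using (_∘_)
open import Relation.Nullary using (¬_; yes; no)
open import Relation.Nullary.Decidable using (from-yes)
open import Relation.Binary.PropositionalEquality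

open import Defs

open +-*-Solver

∑ : ℕ → (ℕ → ℕ) → ℕ
∑ n f = sum (applyUpTo f n)

∑-cong : ∀ n {f g} → (∀ i → i < n → f i ≡ g i) → ∑ n f ≡ ∑ n g
∑-cong zero    _   = refl
∑-cong (suc n) f≗g = cong₂ _+_ (f≗g 0 z<s) (∑-cong n (λ i i<n → f≗g (suc i) (s<s i<n)))

∑-zero : ∀ n → ∑ n (λ _ → 0) ≡ 0
∑-zero zero    = refl
∑-zero (suc n) = ∑-zero n

∑-distrib-+ : ∀ n f g → ∑ n (λ i → f i + g i) ≡ ∑ n f + ∑ n g
∑-distrib-+ zero    f g = refl
∑-distrib-+ (suc n) f g
  rewrite ∑-distrib-+ n (f ∘ suc) (g ∘ suc) =
  solve 4 (λ a b c d → (a :+ b) :+ (c :+ d) := (a :+ c) :+ (b :+ d)) refl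
    (f 0) (g 0) (∑ n (f ∘ suc)) (∑ n (g ∘ suc))

∑-distribˡ-* : ∀ n c f → ∑ n (λ i → c * f i) ≡ c * ∑ n f
∑-distribˡ-* zero    c f = sym (*-zeroʳ c)
∑-distribˡ-* (suc n) c f
  rewrite ∑-distribˡ-* n c (f ∘ suc) = sym (*-distribˡ-+ c (f 0) (∑ n (f ∘ suc)))

∑-++ : ∀ a b f → ∑ (a + b) f ≡ ∑ a f + ∑ b (λ r → f (a + r))
∑-++ zero    b f = refl
∑-++ (suc a) b f
  rewrite ∑-++ a b (f ∘ suc) = sym (+-assoc (f 0) _ _)

∑-blocks : ∀ B p f → ∑ (B * p) f ≡ ∑ B (λ j → ∑ p (λ r → f (j * p + r)))
∑-blocks zero    p f = refl
∑-blocks (suc B) p f = begin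
  ∑ (p + B * p) f                                          ≡⟨ ∑-++ p (B * p) f ⟩
  ∑ p f + ∑ (B * p) (λ r → f (p + r))                      ≡⟨ cong (∑ p f +_) (∑-blocks B p (λ r → f (p + r))) ⟩
  ∑ p f + ∑ B (λ j → ∑ p (λ r → f (p + (j * p + r))))      ≡⟨ cong (∑ p f +_) (∑-cong B λ j _ →
                                                                ∑-cong p λ r _ → cong f (sym (+-assoc p (j * p) r))) ⟩
  ∑ p f + ∑ B (λ j → ∑ p (λ r → f (p + j * p + r)))        ∎
  where open ≡-Reasoning

∑-head : ∀ n .{{_ : NonZero n}} {f g} c → f 0 ≡ g 0 + c →
         (∀ r → suc r < n → f (suc r) ≡ g (suc r)) → ∑ n f ≡ ∑ n g + c
∑-head (suc n) {f} {g} c f0 fs = begin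
  f 0 + ∑ n (f ∘ suc)      ≡⟨ cong₂ _+_ f0 (∑-cong n λ r r<n → fs r (s<s r<n)) ⟩
  g 0 + c + ∑ n (g ∘ suc)  ≡⟨ solve 3 (λ a b d → a :+ b :+ d := a :+ d :+ b) refl (g 0) c (∑ n (g ∘ suc)) ⟩
  g 0 + ∑ n (g ∘ suc) + c  ∎
  where open ≡-Reasoning

δ : ℕ → ℕ → ℕ
δ x d with d ∣? x
... | yes _ = d
... | no  _ = 0

δ-divisor : ∀ {x d} → d ∣ x → δ x d ≡ d
δ-divisor {x} {d} d∣x with d ∣? x
... | yes _   = refl
... | no  d∤x = ⊥-elim (d∤x d∣x)

δ-nondivisor : ∀ {x d} → ¬ d ∣ x → δ x d ≡ 0
δ-nondivisor {x} {d} d∤x with d ∣? x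
... | yes d∣x = ⊥-elim (d∤x d∣x)
... | no  _   = refl

δ-zero : ∀ x → δ x 0 ≡ 0
δ-zero x with 0 ∣? x
... | yes _ = refl
... | no  _ = refl

sum-filter-∣≡sum-map-δ : ∀ x ds → sum (filter (λ d → d ∣? x) ds) ≡ sum (map (δ x) ds)
sum-filter-∣≡sum-map-δ x []       = refl
sum-filter-∣≡sum-map-δ x (d ∷ ds) with d ∣? x
... | yes _ = cong (d +_) (sum-filter-∣≡sum-map-δ x ds)
... | no  _ = sum-filter-∣≡sum-map-δ x ds

σ≡∑δ : ∀ x → σ x ≡ ∑ (suc x) (δ x)
σ≡∑δ x = begin
  σ x                                           ≡⟨ sum-filter-∣≡sum-map-δ x (map suc (upTo x)) ⟩
  sum (map (δ x) (map suc (upTo x)))            ≡⟨ cong (sum ∘ map (δ x)) (map-upTo suc x) ⟩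
  sum (map (δ x) (applyUpTo suc x))             ≡⟨ cong sum (map-applyUpTo suc (δ x) x) ⟩
  ∑ x (δ x ∘ suc)                               ≡⟨ cong (_+ ∑ x (δ x ∘ suc)) (sym (δ-zero x)) ⟩
  δ x 0 + ∑ x (δ x ∘ suc)                       ∎
  where open ≡-Reasoning

σ≡∑δ-beyond : ∀ {x n} → 0 < x → x < n → σ x ≡ ∑ n (δ x)
σ≡∑δ-beyond {x} 0<x x<n with m≤n⇒∃[o]m+o≡n x<n
... | b , refl = begin
  σ x                                            ≡⟨ σ≡∑δ x ⟩
  ∑ (suc x) (δ x)                                ≡⟨ +-identityʳ _ ⟨
  ∑ (suc x) (δ x) + 0                            ≡⟨ cong (∑ (suc x) (δ x) +_) (∑-zero b) ⟨
  ∑ (suc x) (δ x) + ∑ b (λ _ → 0)                ≡⟨ cong (∑ (suc x) (δ x) +_) (∑-cong b λ r _ → δ-beyond r) ⟨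
  ∑ (suc x) (δ x) + ∑ b (λ r → δ x (suc x + r))  ≡⟨ ∑-++ (suc x) b (δ x) ⟨
  ∑ (suc x + b) (δ x)                            ∎
  where
  open ≡-Reasoning
  δ-beyond : ∀ r → δ x (suc x + r) ≡ 0
  δ-beyond r = δ-nondivisor λ d∣x → <⇒≱ (s≤s (m≤m+n x r)) (∣⇒≤ {{>-nonZero 0<x}} d∣x)

δ-coprime : ∀ {a m d} → Coprime d a → δ (a * m) d ≡ δ m d
δ-coprime {a} {m} {d} d⊥a with d ∣? m
... | yes d∣m = δ-divisor (∣n⇒∣m*n a d∣m)
... | no  d∤m = δ-nondivisor (d∤m ∘ coprime-divisor d⊥a)

δ-multiple : ∀ p X j .{{_ : NonZero p}} → δ (p * X) (j * p) ≡ p * δ X j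
δ-multiple p X j with j ∣? X
... | yes j∣X = trans (δ-divisor (subst (_∣ p * X) (*-comm p j) (*-monoʳ-∣ p j∣X))) (*-comm j p)
... | no  j∤X = trans (δ-nondivisor (j∤X ∘ *-cancelˡ-∣ p ∘ subst (_∣ p * X) (*-comm j p))) (sym (*-zeroʳ p))

prime∤⇒coprime : ∀ {p a} → Prime p → ¬ p ∣ a → Coprime a p
prime∤⇒coprime prime[p] p∤a (d∣a , d∣p) with prime⇒irreducible prime[p] d∣p
... | inj₁ d≡1 = d≡1
... | inj₂ refl = ⊥-elim (p∤a d∣a)

coprime-∣ˡ : ∀ {a b d} → d ∣ a → Coprime a b → Coprime d b
coprime-∣ˡ d∣a a⊥b (e∣d , e∣b) = a⊥b (∣-trans e∣d d∣a , e∣b)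

coprime-*ʳ : ∀ {a b c} → Coprime a b → Coprime a c → Coprime a (b * c)
coprime-*ʳ {a} {b} a⊥b a⊥c (d∣a , d∣bc) =
  a⊥c (d∣a , coprime-divisor (coprime-∣ˡ d∣a a⊥b) d∣bc)

coprime-^ʳ : ∀ {a p} e → Coprime a p → Coprime a (p ^ e)
coprime-^ʳ zero    a⊥p (_ , d∣1) = ∣1⇒≡1 d∣1
coprime-^ʳ (suc e) a⊥p = coprime-*ʳ a⊥p (coprime-^ʳ e a⊥p)

module _ {p : ℕ} (prime[p] : Prime p) where

  private instance
    nonZero[p] : NonZero p
    nonZero[p] = prime⇒nonZero prime[p]

  p∤1 : ¬ p ∣ 1
  p∤1 p∣1 = ¬prime[1] (subst Prime (∣1⇒≡1 p∣1) prime[p])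

  p∤[jp+1+r] : ∀ j r → suc r < p → ¬ p ∣ j * p + suc r
  p∤[jp+1+r] j r 1+r<p p∣ = <⇒≱ 1+r<p (∣⇒≤ (∣m+n∣m⇒∣n p∣ (n∣m*n j)))

  -- In the block [jp, jp + p) the point jp divides pX exactly when j divides X and never
  -- divides m; the other points are prime to p, so they divide pX exactly when they divide m.
  ∑-block : ∀ e {m} → ¬ p ∣ m → ∀ j →
            ∑ p (λ r → δ (p * (p ^ e * m)) (j * p + r)) ≡ ∑ p (λ r → δ m (j * p + r)) + p * δ (p ^ e * m) j
  ∑-block e {m} p∤m j = ∑-head p _ head tail
    where
    head : δ (p * (p ^ e * m)) (j * p + 0) ≡ δ m (j * p + 0) + p * δ (p ^ e * m) j
    head rewrite +-identityʳ (j * p)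
               | δ-nondivisor {m} {j * p} (p∤m ∘ ∣-trans (n∣m*n j)) = δ-multiple p (p ^ e * m) j
    tail : ∀ r → suc r < p → δ (p * (p ^ e * m)) (j * p + suc r) ≡ δ m (j * p + suc r)
    tail r 1+r<p rewrite sym (*-assoc p (p ^ e) m) =
      δ-coprime (coprime-^ʳ (suc e) (prime∤⇒coprime prime[p] (p∤[jp+1+r] j r 1+r<p)))

  σ[p*p^e*m] : ∀ e {m} → ¬ p ∣ m → 0 < m → σ (p * (p ^ e * m)) ≡ σ m + p * σ (p ^ e * m)
  σ[p*p^e*m] e {m} p∤m 0<m = begin
    σ (p * X)                                                    ≡⟨ σ≡∑δ-beyond 0<pX pX<[1+X]p ⟩
    ∑ (suc X * p) (δ (p * X))                                    ≡⟨ ∑-blocks (suc X) p (δ (p * X)) ⟩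
    ∑ (suc X) (λ j → ∑ p (λ r → δ (p * X) (j * p + r)))          ≡⟨ ∑-cong (suc X) (λ j _ → ∑-block e p∤m j) ⟩
    ∑ (suc X) (λ j → ∑ p (λ r → δ m (j * p + r)) + p * δ X j)    ≡⟨ ∑-distrib-+ (suc X) (λ j → ∑ p (λ r → δ m (j * p + r))) (λ j → p * δ X j) ⟩
    ∑ (suc X) (λ j → ∑ p (λ r → δ m (j * p + r))) + ∑ (suc X) (λ j → p * δ X j)
        ≡⟨ cong₂ _+_ (sym (∑-blocks (suc X) p (δ m))) (∑-distribˡ-* (suc X) p (δ X)) ⟩
    ∑ (suc X * p) (δ m) + p * ∑ (suc X) (δ X)                    ≡⟨ cong₂ _+_ (σ≡∑δ-beyond 0<m m<[1+X]p) (cong (p *_) (σ≡∑δ X)) ⟨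
    σ m + p * σ X                                                ∎
    where
    open ≡-Reasoning
    X : ℕ
    X = p ^ e * m
    m≤X : m ≤ X
    m≤X = m≤n*m m (p ^ e) {{m^n≢0 p e}}
    0<pX : 0 < p * X
    0<pX = *-mono-< (>-nonZero⁻¹ p) (<-≤-trans 0<m m≤X)
    pX<[1+X]p : p * X < suc X * p
    pX<[1+X]p = subst (_< suc X * p) (*-comm X p) (m<n+m (X * p) (>-nonZero⁻¹ p))
    m<[1+X]p : m < suc X * p
    m<[1+X]p = <-≤-trans (s≤s m≤X) (m≤m*n (suc X) p)

  σ[p^1+e] : ∀ e → σ (p ^ suc e) ≡ 1 + p * σ (p ^ e)
  σ[p^1+e] e = subst (λ y → σ (p * y) ≡ 1 + p * σ y) (*-identityʳ (p ^ e)) (σ[p*p^e*m] e p∤1 z<s)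

  σ[p^e*m] : ∀ e {m} → ¬ p ∣ m → 0 < m → σ (p ^ e * m) ≡ σ (p ^ e) * σ m
  σ[p^e*m] zero    {m} p∤m 0<m = trans (cong σ (*-identityˡ m)) (sym (*-identityˡ (σ m)))
  σ[p^e*m] (suc e) {m} p∤m 0<m = begin
    σ (p * p ^ e * m)               ≡⟨ cong σ (*-assoc p (p ^ e) m) ⟩
    σ (p * (p ^ e * m))             ≡⟨ σ[p*p^e*m] e p∤m 0<m ⟩
    σ m + p * σ (p ^ e * m)         ≡⟨ cong (λ s → σ m + p * s) (σ[p^e*m] e p∤m 0<m) ⟩
    σ m + p * (σ (p ^ e) * σ m)     ≡⟨ solve 3 (λ s p t → s :+ p :* (t :* s) := (con 1 :+ p :* t) :* s) refl (σ m) p (σ (p ^ e)) ⟩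
    (1 + p * σ (p ^ e)) * σ m       ≡⟨ cong (_* σ m) (σ[p^1+e] e) ⟨
    σ (p ^ suc e) * σ m             ∎
    where open ≡-Reasoning

  0<σ[p^e] : ∀ e → 0 < σ (p ^ e)
  0<σ[p^e] zero    = z<s
  0<σ[p^e] (suc e) rewrite σ[p^1+e] e = z<s

  1+p≤σ[p^1+e] : ∀ e → 1 + p ≤ σ (p ^ suc e)
  1+p≤σ[p^1+e] e rewrite σ[p^1+e] e = s≤s (m≤m*n p (σ (p ^ e)) {{>-nonZero (0<σ[p^e] e)}})

  σ[p^1+e]-coprime : ∀ e → Coprime (σ (p ^ suc e)) p
  σ[p^1+e]-coprime e {d} (d∣σ , d∣p) rewrite σ[p^1+e] e =
    ∣1⇒≡1 (∣m+n∣m⇒∣n (subst (d ∣_) (+-comm 1 (p * σ (p ^ e))) d∣σ) (∣m⇒∣m*n (σ (p ^ e)) d∣p))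

  2∣σ[p^odd] : Odd p → ∀ {e} → Odd e → 2 ∣ σ (p ^ e)
  2∣σ[p^odd] (c , p≡2c+1) (t , refl) = 2∣σ[p^[2t+1]] t
    where
    2∣1+p : 2 ∣ 1 + p
    2∣1+p = divides (suc c) (trans (cong suc p≡2c+1)
      (solve 1 (λ c → con 1 :+ (con 2 :* c :+ con 1) := (con 1 :+ c) :* con 2) refl c))
    σ[p^[2+e]] : ∀ e → σ (p ^ (2 + e)) ≡ (1 + p) + p * p * σ (p ^ e)
    σ[p^[2+e]] e rewrite σ[p^1+e] (suc e) | σ[p^1+e] e =
      solve 2 (λ p s → con 1 :+ p :* (con 1 :+ p :* s) := (con 1 :+ p) :+ p :* p :* s) refl p (σ (p ^ e))
    2∣σ[p^[2t+1]] : ∀ t → 2 ∣ σ (p ^ (2 * t + 1))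
    2∣σ[p^[2t+1]] zero rewrite σ[p^1+e] 0 | *-identityʳ p = 2∣1+p
    2∣σ[p^[2t+1]] (suc t) =
      subst (λ e → 2 ∣ σ (p ^ e)) (solve 1 (λ t → con 2 :+ (con 2 :* t :+ con 1) := con 2 :* (con 1 :+ t) :+ con 1) refl t)
        (subst (2 ∣_) (sym (σ[p^[2+e]] (2 * t + 1)))
          (∣m∣n⇒∣m+n 2∣1+p (∣n⇒∣m*n (p * p) (2∣σ[p^[2t+1]] t))))

odd⇒2∤ : ∀ {x} → Odd x → ¬ 2 ∣ x
odd⇒2∤ (M , refl) 2∣2M+1 with ∣⇒≤ (∣m+n∣m⇒∣n 2∣2M+1 (m∣m*n M))
... | s≤s ()

2∤* : ∀ {a b} → ¬ 2 ∣ a → ¬ 2 ∣ b → ¬ 2 ∣ a * b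
2∤* {a} {b} 2∤a 2∤b 2∣ab with euclidsLemma a b prime[2] 2∣ab
... | inj₁ 2∣a = 2∤a 2∣a
... | inj₂ 2∣b = 2∤b 2∣b

3≤odd<9⇒prime : ∀ F → 3 ≤ F → F < 9 → ¬ 2 ∣ F → Prime F
3≤odd<9⇒prime 0 () _ _
3≤odd<9⇒prime 1 (s≤s ()) _ _
3≤odd<9⇒prime 2 (s≤s (s≤s ())) _ _
3≤odd<9⇒prime 3 _ _ _   = from-yes (prime? 3)
3≤odd<9⇒prime 4 _ _ 2∤4 = ⊥-elim (2∤4 (divides 2 refl))
3≤odd<9⇒prime 5 _ _ _   = from-yes (prime? 5)
3≤odd<9⇒prime 6 _ _ 2∤6 = ⊥-elim (2∤6 (divides 3 refl))
3≤odd<9⇒prime 7 _ _ _   = from-yes (prime? 7)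
3≤odd<9⇒prime 8 _ _ 2∤8 = ⊥-elim (2∤8 (divides 4 refl))
3≤odd<9⇒prime (suc (suc (suc (suc (suc (suc (suc (suc (suc _))))))))) _ F<9 _ = ⊥-elim (<⇒≱ F<9 (m≤m+n 9 _))

prime∣n*n⇒∣n : ∀ {p n} → Prime p → p ∣ n * n → p ∣ n
prime∣n*n⇒∣n {n = n} prime[p] p∣nn with euclidsLemma n n prime[p] p∣nn
... | inj₁ p∣n = p∣n
... | inj₂ p∣n = p∣n

prime∣square⇒∣cofactor : ∀ {p n m} → Prime p → n * n ≡ m * p → p ∣ m
prime∣square⇒∣cofactor {p} {n} {m} prime[p] n²≡mp with prime∣n*n⇒∣n {n = n} prime[p] (divides m n²≡mp)
... | divides c refl = divides (c * c) (*-cancelʳ-≡ m (c * c * p) p {{prime⇒nonZero prime[p]}}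
  (trans (sym n²≡mp) (solve 2 (λ c p → c :* p :* (c :* p) := c :* c :* p :* p) refl c p)))

gcd[F*2,s]∣F : ∀ F {s} → ¬ 2 ∣ s → gcd (F * 2) s ∣ F
gcd[F*2,s]∣F F {s} 2∤s = coprime-divisor
  (prime∤⇒coprime prime[2] (λ 2∣G → 2∤s (∣-trans 2∣G (gcd[m,n]∣n (F * 2) s))))
  (subst (gcd (F * 2) s ∣_) (*-comm F 2) (gcd[m,n]∣m (F * 2) s))

module _ {n m F : ℕ} (2∤n : ¬ 2 ∣ n) (n²≡mF : n * n ≡ m * F) (3≤F : 3 ≤ F) where

  private instance
    nonZero[n] : NonZero n
    nonZero[n] = ≢-nonZero λ { refl → 2∤n (2 ∣0) }
    nonZero[F] : NonZero F
    nonZero[F] = >-nonZero (<-≤-trans z<s 3≤F)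
    nonZero[gcd[n,m]] : NonZero (gcd n m)
    nonZero[gcd[n,m]] = ≢-nonZero (gcd[m,n]≢0 n m (inj₁ (≢-nonZero⁻¹ n)))

  2∤F : ¬ 2 ∣ F
  2∤F 2∣F = 2∤* 2∤n 2∤n (∣-trans 2∣F (divides m n²≡mF))

  2∤m : ¬ 2 ∣ m
  2∤m 2∣m = 2∤* 2∤n 2∤n (∣-trans 2∣m (divides F (trans n²≡mF (*-comm m F))))

  n∣gcd[n,m]*F : n ∣ gcd n m * F
  n∣gcd[n,m]*F = subst (_∣ g * F) (m*[n/m]≡n g∣n) (*-monoʳ-∣ g n′∣F)
    where
    g n′ m′ : ℕ
    g = gcd n m
    n′ = n / g
    m′ = m / g
    g∣n : g ∣ n
    g∣n = gcd[m,n]∣m n m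
    n′n≡m′F : n′ * n ≡ m′ * F
    n′n≡m′F = *-cancelˡ-≡ (n′ * n) (m′ * F) g (begin
      g * (n′ * n)  ≡⟨ *-assoc g n′ n ⟨
      g * n′ * n    ≡⟨ cong (_* n) (m*[n/m]≡n g∣n) ⟩
      n * n         ≡⟨ n²≡mF ⟩
      m * F         ≡⟨ cong (_* F) (m*[n/m]≡n (gcd[m,n]∣n n m)) ⟨
      g * m′ * F    ≡⟨ *-assoc g m′ F ⟩
      g * (m′ * F)  ∎)
      where open ≡-Reasoning
    n′∣F : n′ ∣ F
    n′∣F = coprime-divisor (coprime-/gcd n m) (divides n (trans (sym n′n≡m′F) (*-comm n′ n)))

  3n≤gcd[n,m]*F : 3 * n ≤ gcd n m * F
  3n≤gcd[n,m]*F with n∣gcd[n,m]*F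
  ... | divides 0 gF≡0 = ⊥-elim (≢-nonZero⁻¹ (gcd n m * F) {{m*n≢0 (gcd n m) F}} gF≡0)
  ... | divides 1 gF≡n = ⊥-elim (<⇒≱ (s≤s (s≤s z≤n)) (subst (3 ≤_) F≡1 3≤F))
    where
    g : ℕ
    g = gcd n m
    ng≡m : n * g ≡ m
    ng≡m = *-cancelʳ-≡ (n * g) m F (begin
      n * g * F    ≡⟨ *-assoc n g F ⟩
      n * (g * F)  ≡⟨ cong (n *_) (trans gF≡n (+-identityʳ n)) ⟩
      n * n        ≡⟨ n²≡mF ⟩
      m * F        ∎)
      where open ≡-Reasoning
    g≡n : g ≡ n
    g≡n = ∣-antisym (gcd[m,n]∣m n m) (gcd-greatest ∣-refl (divides g (trans (sym ng≡m) (*-comm n g))))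
    F≡1 : F ≡ 1
    F≡1 = *-cancelˡ-≡ F 1 n (trans (subst (λ x → x * F ≡ 1 * n) g≡n gF≡n) (*-comm 1 n))
  ... | divides 2 gF≡2n = ⊥-elim (2∤gF (divides n (trans gF≡2n (*-comm 2 n))))
    where
    2∤gF : ¬ 2 ∣ gcd n m * F
    2∤gF = 2∤* (λ 2∣g → 2∤n (∣-trans 2∣g (gcd[m,n]∣m n m))) 2∤F
  ... | divides (suc (suc (suc t))) gF≡tn = subst (3 * n ≤_) (sym gF≡tn) (*-monoˡ-≤ n (m≤m+n 3 t))

  gcd[F*2,Qm]-bounds : ∀ {Q} → ¬ 2 ∣ Q → 9 ≤ gcd (F * 2) (Q * m) * F × gcd (F * 2) (Q * m) ≤ F
  gcd[F*2,Qm]-bounds {Q} 2∤Q = 9≤GF , ∣⇒≤ (gcd[F*2,s]∣F F (2∤* 2∤Q 2∤m))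
    where
    G : ℕ
    G = gcd (F * 2) (Q * m)
    instance
      nonZero[G] : NonZero G
      nonZero[G] = ≢-nonZero (gcd[m,n]≢0 (F * 2) (Q * m) (inj₁ (≢-nonZero⁻¹ (F * 2) {{m*n≢0 F 2}})))
    9≤GF : 9 ≤ G * F
    9≤GF with F <? 9
    ... | no  F≮9 = ≤-trans (≮⇒≥ F≮9) (m≤n*m F G)
    ... | yes F<9 = ≤-trans (*-mono-≤ 3≤F 3≤F) (*-monoˡ-≤ F (∣⇒≤ F∣G))
      where
      F∣G : F ∣ G
      F∣G = gcd-greatest (m∣m*n 2) (∣n⇒∣m*n Q (prime∣square⇒∣cofactor {n = n} (3≤odd<9⇒prime F 3≤F F<9 2∤F) n²≡mF))

  gcd[n,Qm]-bounds : ∀ Q → 3 * n ≤ gcd n (Q * m) * F × gcd n (Q * m) ≤ n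
  gcd[n,Qm]-bounds Q = ≤-trans 3n≤gcd[n,m]*F (*-monoˡ-≤ F (∣⇒≤ gcd[n,m]∣I)) , ∣⇒≤ (gcd[m,n]∣m n (Q * m))
    where
    instance
      nonZero[I] : NonZero (gcd n (Q * m))
      nonZero[I] = ≢-nonZero (gcd[m,n]≢0 n (Q * m) (inj₁ (≢-nonZero⁻¹ n)))
    gcd[n,m]∣I : gcd n m ∣ gcd n (Q * m)
    gcd[n,m]∣I = gcd-greatest (gcd[m,n]∣m n m) (∣n⇒∣m*n Q (gcd[m,n]∣n n m))

  J-bounds : ∀ {Q J} → Coprime F Q → gcd (n * n) (Q * m) ≡ J * gcd n (Q * m) → n ≤ J * F × 3 * J ≤ n
  J-bounds {Q} {J} F⊥Q H≡JI = n≤JF , 3J≤n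
    where
    I : ℕ
    I = gcd n (Q * m)
    instance
      nonZero[I] : NonZero I
      nonZero[I] = ≢-nonZero (gcd[m,n]≢0 n (Q * m) (inj₁ (≢-nonZero⁻¹ n)))
    I-bounds : 3 * n ≤ I * F × I ≤ n
    I-bounds = gcd[n,Qm]-bounds Q
    JI≡m : J * I ≡ m
    JI≡m = begin
      J * I                     ≡⟨ H≡JI ⟨
      gcd (n * n) (Q * m)       ≡⟨ cong₂ gcd n²≡mF (*-comm Q m) ⟩
      gcd (m * F) (m * Q)       ≡⟨ c*gcd[m,n]≡gcd[cm,cn] m F Q ⟨
      m * gcd F Q               ≡⟨ cong (m *_) (coprime⇒gcd≡1 F⊥Q) ⟩
      m * 1                     ≡⟨ *-identityʳ m ⟩
      m                         ∎
      where open ≡-Reasoning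
    n²≡I*JF : n * n ≡ I * (J * F)
    n²≡I*JF = begin
      n * n                     ≡⟨ n²≡mF ⟩
      m * F                     ≡⟨ cong (_* F) JI≡m ⟨
      J * I * F                 ≡⟨ solve 3 (λ J I F → J :* I :* F := I :* (J :* F)) refl J I F ⟩
      I * (J * F)               ∎
      where open ≡-Reasoning
    n≤JF : n ≤ J * F
    n≤JF = *-cancelˡ-≤ I (≤-trans (*-monoˡ-≤ n (proj₂ I-bounds)) (≤-reflexive n²≡I*JF))
    3J≤n : 3 * J ≤ n
    3J≤n = *-cancelˡ-≤ (I * F) {{m*n≢0 I F}} (begin
      I * F * (3 * J)           ≡⟨ solve 3 (λ J I F → I :* F :* (con 3 :* J) := con 3 :* (I :* (J :* F))) refl J I F ⟩
      3 * (I * (J * F))         ≡⟨ cong (3 *_) n²≡I*JF ⟨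
      3 * (n * n)               ≡⟨ *-assoc 3 n n ⟨
      3 * n * n                 ≤⟨ *-monoˡ-≤ n (proj₁ I-bounds) ⟩
      I * F * n                 ∎)
      where open ≤-Reasoning

prime[4a+1]⇒5≤ : ∀ {p} a → Prime p → p ≡ 4 * a + 1 → 5 ≤ p
prime[4a+1]⇒5≤ zero    prime[1] refl = ⊥-elim (¬prime[1] prime[1])
prime[4a+1]⇒5≤ (suc a) _        refl = +-monoˡ-≤ 1 (*-monoʳ-≤ 4 (s≤s (z≤n {a})))

σ[q^k]≡F*2 : ∀ {q k} a b → Prime q → q ≡ 4 * a + 1 → k ≡ 4 * b + 1 →
             ∃ λ F → σ (q ^ k) ≡ F * 2 × Coprime F (q ^ k) × 3 ≤ F
σ[q^k]≡F*2 {q} {k} a b prime[q] q≡4a+1 k≡4b+1 = F , σ[Q]≡F*2 , F⊥Q , 3≤F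
  where
  k≡1+4b : k ≡ suc (4 * b)
  k≡1+4b = trans k≡4b+1 (+-comm (4 * b) 1)
  2∣σ[Q] : 2 ∣ σ (q ^ k)
  2∣σ[Q] = 2∣σ[p^odd] prime[q] (2 * a , trans q≡4a+1 (cong (_+ 1) (*-assoc 2 2 a)))
                               (2 * b , trans k≡4b+1 (cong (_+ 1) (*-assoc 2 2 b)))
  F : ℕ
  F = _∣_.quotient 2∣σ[Q]
  σ[Q]≡F*2 : σ (q ^ k) ≡ F * 2
  σ[Q]≡F*2 = _∣_.equality 2∣σ[Q]
  F⊥Q : Coprime F (q ^ k)
  F⊥Q = coprime-^ʳ k (coprime-∣ˡ (subst (F ∣_) (sym σ[Q]≡F*2) (m∣m*n 2))
    (subst (λ e → Coprime (σ (q ^ e)) q) (sym k≡1+4b) (σ[p^1+e]-coprime prime[q] (4 * b))))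
  3≤F : 3 ≤ F
  3≤F = *-cancelʳ-≤ 3 F 2 (begin
    6              ≤⟨ s≤s (prime[4a+1]⇒5≤ a prime[q] q≡4a+1) ⟩
    1 + q          ≤⟨ subst (λ e → 1 + q ≤ σ (q ^ e)) (sym k≡1+4b) (1+p≤σ[p^1+e] prime[q] (4 * b)) ⟩
    σ (q ^ k)      ≡⟨ σ[Q]≡F*2 ⟩
    F * 2          ∎)
    where open ≤-Reasoning

record EulerianFactorisation (n Q : ℕ) : Set where
  constructor factorisation
  field
    2∤n      : ¬ 2 ∣ n
    2∤Q      : ¬ 2 ∣ Q
    F m      : ℕ
    σ[Q]≡F*2 : σ Q ≡ F * 2
    n²≡mF    : n * n ≡ m * F
    σ[n²]≡Qm : σ (n * n) ≡ Q * m
    F⊥Q      : Coprime F Q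
    3≤F      : 3 ≤ F

-- Opaque, so that the rewrites in corollary2 do not unfold σ at the constructed witnesses.
opaque
  eulerian-factorisation : ∀ {N q k n} → EulerianOPN N q k n → EulerianFactorisation n (q ^ k)
  eulerian-factorisation {N} {q} {k} {n} (odd[N] , perfect , N≡Qn² , prime[q] , (a , q≡4a+1) , (b , k≡4b+1) , gcd[q,n]≡1)
    with σ[q^k]≡F*2 a b prime[q] q≡4a+1 k≡4b+1
  ... | F , σ[Q]≡F*2 , F⊥Q , 3≤F = factorisation 2∤n 2∤Q F m σ[Q]≡F*2 n²≡mF σ[n²]≡Qm F⊥Q 3≤F
    where
    Q : ℕ
    Q = q ^ k
    2∤N : ¬ 2 ∣ Q * (n * n)
    2∤N 2∣N = odd⇒2∤ odd[N] (subst (2 ∣_) (sym N≡Qn²) 2∣N)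
    2∤n : ¬ 2 ∣ n
    2∤n 2∣n = 2∤N (∣n⇒∣m*n Q (∣m⇒∣m*n n 2∣n))
    2∤Q : ¬ 2 ∣ Q
    2∤Q 2∣Q = 2∤N (∣m⇒∣m*n (n * n) 2∣Q)
    0<n² : 0 < n * n
    0<n² = *-mono-< 0<n 0<n
      where
      0<n : 0 < n
      0<n = n≢0⇒n>0 λ { refl → 2∤n (2 ∣0) }
    q∤n² : ¬ q ∣ n * n
    q∤n² q∣n² = p∤1 prime[q] (subst (q ∣_) gcd[q,n]≡1 (gcd-greatest ∣-refl (prime∣n*n⇒∣n prime[q] q∣n²)))
    Fσ[n²]≡Qn² : F * σ (n * n) ≡ Q * (n * n)
    Fσ[n²]≡Qn² = *-cancelˡ-≡ _ _ 2 (begin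
      2 * (F * σ (n * n))   ≡⟨ solve 2 (λ F s → con 2 :* (F :* s) := F :* con 2 :* s) refl F (σ (n * n)) ⟩
      F * 2 * σ (n * n)     ≡⟨ cong (_* σ (n * n)) σ[Q]≡F*2 ⟨
      σ Q * σ (n * n)       ≡⟨ σ[p^e*m] prime[q] k q∤n² 0<n² ⟨
      σ (Q * (n * n))       ≡⟨ cong σ N≡Qn² ⟨
      σ N                   ≡⟨ perfect ⟩
      2 * N                 ≡⟨ cong (2 *_) N≡Qn² ⟩
      2 * (Q * (n * n))     ∎)
      where open ≡-Reasoning
    F∣n² : F ∣ n * n
    F∣n² = coprime-divisor F⊥Q (divides (σ (n * n)) (trans (sym Fσ[n²]≡Qn²) (*-comm F _)))
    m : ℕ
    m = _∣_.quotient F∣n²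
    n²≡mF : n * n ≡ m * F
    n²≡mF = _∣_.equality F∣n²
    σ[n²]≡Qm : σ (n * n) ≡ Q * m
    σ[n²]≡Qm = *-cancelˡ-≡ _ _ F {{>-nonZero (<-≤-trans z<s 3≤F)}} (begin
      F * σ (n * n)   ≡⟨ Fσ[n²]≡Qn² ⟩
      Q * (n * n)     ≡⟨ cong (Q *_) n²≡mF ⟩
      Q * (m * F)     ≡⟨ solve 3 (λ Q m F → Q :* (m :* F) := F :* (Q :* m)) refl Q m F ⟩
      F * (Q * m)     ∎)
      where open ≡-Reasoning

corollary2 : (N q k n : ℕ) → EulerianOPN N q k n →
    (J : ℕ) → gcd (n * n) (σ (n * n)) ≡ J * gcd n (σ (n * n)) →
    (9 ≤ gcd (σ (q ^ k)) (σ (n * n)) * (σ (q ^ k) / 2) ×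
     gcd (σ (q ^ k)) (σ (n * n)) ≤ σ (q ^ k) / 2) ×
    (3 * n ≤ gcd n (σ (n * n)) * (σ (q ^ k) / 2) ×
     gcd n (σ (n * n)) ≤ n) ×
    (n ≤ J * (σ (q ^ k) / 2) ×
     3 * J ≤ n)
corollary2 N q k n opn J H≡JI with eulerian-factorisation opn
... | factorisation 2∤n 2∤Q F m σ[Q]≡F*2 n²≡mF σ[n²]≡Qm F⊥Q 3≤F
  rewrite σ[Q]≡F*2 | σ[n²]≡Qm | m*n/n≡m F 2 {{_}} =
  gcd[F*2,Qm]-bounds 2∤n n²≡mF 3≤F 2∤Q ,
  gcd[n,Qm]-bounds 2∤n n²≡mF 3≤F (q ^ k) ,
  J-bounds 2∤n n²≡mF 3≤F {J = J} F⊥Q H≡JI
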